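{- For $n\in\mathbb{N}$, let $R_n$ be the digraph with $V(R_n)=\{x,y,z_1,\dots,z_n\}$ and $A(R_n)=\{(y,x)\}\cup\bigcup_{i=1}^n\{(x,z_i),(z_i,y)\}$. Then $\kappa(R_n)=1$ for every $n\in\mathbb{N}$.
   Context: A kernel of a digraph $D$ is a set $N\subseteq V(D)$ that is independent (no arc between two vertices of $N$) and absorbent (for every $u\in V(D)\setminus N$ there is $v\in N$ with $(u,v)\in A(D)$). Subdividing an arc $(u,v)$ means replacing it by a new vertex $a$ and the arcs $(u,a),(a,v)$. For $\Lambda\subseteq A(D)$, $D_\Lambda$ is obtained from $D$ by subdividing every arc of $\Lambda$. $\kappa(D)$ is the smallest cardinality of $\Lambda\subseteq A(D)$ such that $D_\Lambda$ has a kernel. -}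

module Defs where

open import Data.Nat using (ℕ; zero; suc; _≤_)
open import Data.Bool using (Bool; true; false)
open import Data.Fin using (Fin) renaming (zero to f0; suc to fs)
open import Data.Fin.Subset using (Subset; _∈_; _∉_; ∣_∣)
open import Data.List using (List; []; _∷_; length; lookup; concatMap; allFin)
open import Data.Product using (Σ; _×_; _,_; proj₁; proj₂)
open import Data.Sum using (_⊎_; inj₁; inj₂)
open import Relation.Binary.PropositionalEquality using (_≡_)
open import Relation.Nullary using (¬_)

-- A finite digraph: vertex set Fin order, arc set given as a list of ordered pairs
-- (intended without repetitions).
record Digraph : Set where
  field
    order : ℕ
    arcs  : List (Fin order × Fin order)

Independent : {V : Set} → (V → V → Set) → (V → Bool) → Set
Independent {V} _⇒_ N = (u v : V) → N u ≡ true → N v ≡ true → ¬ (u ⇒ v)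

Absorbent : {V : Set} → (V → V → Set) → (V → Bool) → Set
Absorbent {V} _⇒_ N = (u : V) → N u ≡ false → Σ V (λ v → N v ≡ true × (u ⇒ v))

IsKernel : {V : Set} → (V → V → Set) → (V → Bool) → Set
IsKernel _⇒_ N = Independent _⇒_ N × Absorbent _⇒_ N

HasKernel : (V : Set) → (V → V → Set) → Set
HasKernel V _⇒_ = Σ (V → Bool) (λ N → IsKernel _⇒_ N)

module _ (D : Digraph) where
  open Digraph D

  ArcSet : Set
  ArcSet = Subset (length arcs)

  src : Fin (length arcs) → Fin order
  src i = proj₁ (lookup arcs i)

  tgt : Fin (length arcs) → Fin order
  tgt i = proj₂ (lookup arcs i)

  data Arc : Fin order → Fin order → Set where
    arc : (i : Fin (length arcs)) → Arc (src i) (tgt i)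

  SubV : ArcSet → Set
  SubV Λ = Fin order ⊎ Σ (Fin (length arcs)) (λ i → i ∈ Λ)

  -- Arcs of D_Λ: arcs not in Λ are kept; each arc (u,v) in Λ is replaced by
  -- (u,a),(a,v) with a the new vertex.
  data SubArc (Λ : ArcSet) : SubV Λ → SubV Λ → Set where
    keep : (i : Fin (length arcs)) → i ∉ Λ → SubArc Λ (inj₁ (src i)) (inj₁ (tgt i))
    into : (i : Fin (length arcs)) (p : i ∈ Λ) → SubArc Λ (inj₁ (src i)) (inj₂ (i , p))
    outof : (i : Fin (length arcs)) (p : i ∈ Λ) → SubArc Λ (inj₂ (i , p)) (inj₁ (tgt i))

  SubHasKernel : ArcSet → Set
  SubHasKernel Λ = HasKernel (SubV Λ) (SubArc Λ)

  IsKappa : ℕ → Set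
  IsKappa k = Σ ArcSet (λ Λ → ∣ Λ ∣ ≡ k × SubHasKernel Λ)
            × ((Λ : ArcSet) → SubHasKernel Λ → k ≤ ∣ Λ ∣)

R : ℕ → Digraph
R n = record
  { order = suc (suc n)
  ; arcs  = (y , x) ∷ concatMap (λ i → (x , z i) ∷ (z i , y) ∷ []) (allFin n)
  }
  where
  x y : Fin (suc (suc n))
  x = f0
  y = fs f0
  z : Fin n → Fin (suc (suc n))
  z i = fs (fs i)

-- With no arc subdivided, R_n has no kernel N: if x ∈ N then z₁ ∉ N, so z₁ is
-- absorbed by its only successor y, but y → x; if x ∉ N, some z_j ∈ N absorbs
-- x, so y ∉ N, yet the only successor of y is x ∉ N. Subdividing (y, x) by a
-- new vertex a yields the kernel {z₁, …, z_n, a}.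
module Submission where

open import Defs
open import Data.Nat using (ℕ; suc; _≤_)
open import Data.Bool using (Bool; true; false)
open import Data.Fin using (Fin) renaming (zero to f0; suc to fs)
open import Data.Fin.Subset using (Subset; _∈_; ∣_∣; ⁅_⁆; Nonempty; Empty)
open import Data.Fin.Subset.Properties
  using (x∈⁅x⁆; x∈⁅y⁆⇒x≡y; x≢y⇒x∉⁅y⁆; ∣⁅x⁆∣≡1; p⊆q⇒∣p∣≤∣q∣; nonempty?)
open import Data.List using (_∷_; []; length; allFin)
open import Data.List.Relation.Unary.All as All using (All; _∷_; [])
open import Data.List.Relation.Unary.All.Properties using (concat⁺; map⁺)
open import Data.List.Relation.Unary.Any as Any using (here; there)
open import Data.List.Relation.Unary.Any.Properties using (lookup-index)
import Data.List.Membership.Propositional as List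
open import Data.List.Membership.Propositional.Properties
  using (∈-lookup; ∈-concatMap⁺; ∈-allFin)
open import Data.Product using (Σ; _×_; _,_)
open import Data.Sum using (inj₁; inj₂)
open import Data.Empty using (⊥; ⊥-elim)
open import Relation.Binary.PropositionalEquality using (_≡_; refl; sym; trans; subst)
open import Relation.Nullary using (¬_; yes; no)

nonempty⇒1≤∣p∣ : ∀ {k} {p : Subset k} → Nonempty p → 1 ≤ ∣ p ∣
nonempty⇒1≤∣p∣ {p = p} (i , i∈p) =
  subst (_≤ ∣ p ∣) (∣⁅x⁆∣≡1 i)
        (p⊆q⇒∣p∣≤∣q∣ λ j∈⁅i⁆ → subst (_∈ p) (sym (x∈⁅y⁆⇒x≡y i j∈⁅i⁆)) i∈p)

module _ (D : Digraph) where
  open Digraph D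

  ∈arcs⇒Arc : ∀ {u v} → (u , v) List.∈ arcs → Arc D u v
  ∈arcs⇒Arc u⇒v =
    subst (λ { (a , b) → Arc D a b }) (sym (lookup-index u⇒v)) (arc (Any.index u⇒v))

  module _ {Λ : ArcSet D} (empty : Empty Λ) where

    unsubdivided-arc : ∀ {u w} → SubArc D Λ (inj₁ u) w →
                       Σ (Fin order) λ v → w ≡ inj₁ v × Arc D u v
    unsubdivided-arc (keep i _)   = _ , refl , arc i
    unsubdivided-arc (into i i∈Λ) = ⊥-elim (empty (i , i∈Λ))

    unsubdivided-kernel : SubHasKernel D Λ → HasKernel (Fin order) (Arc D)
    unsubdivided-kernel (N , independent , absorbent) =
      (λ v → N (inj₁ v)) , independent′ , absorbent′
      where
      independent′ : Independent (Arc D) (λ v → N (inj₁ v))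
      independent′ u v Nu Nv (arc i) =
        independent _ _ Nu Nv (keep i λ i∈Λ → empty (i , i∈Λ))

      absorbent′ : Absorbent (Arc D) (λ v → N (inj₁ v))
      absorbent′ u Nu with absorbent (inj₁ u) Nu
      ... | w , Nw , u⇒w with unsubdivided-arc u⇒w
      ... | v , refl , u⇒v = v , Nw , u⇒v

  kernelless-κ≡1 : ¬ HasKernel (Fin order) (Arc D) →
                   (i : Fin (length arcs)) → SubHasKernel D ⁅ i ⁆ → IsKappa D 1
  kernelless-κ≡1 noKernel i kernel = (⁅ i ⁆ , ∣⁅x⁆∣≡1 i , kernel) , atLeastOne
    where
    atLeastOne : (Λ : ArcSet D) → SubHasKernel D Λ → 1 ≤ ∣ Λ ∣
    atLeastOne Λ K with nonempty? Λ
    ... | yes nonempty = nonempty⇒1≤∣p∣ nonempty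
    ... | no empty     = ⊥-elim (noKernel (unsubdivided-kernel empty K))

module _ {n : ℕ} where
  x y : Fin (suc (suc n))
  x = f0
  y = fs f0

  z : Fin n → Fin (suc (suc n))
  z j = fs (fs j)

  data RArc : Fin (suc (suc n)) → Fin (suc (suc n)) → Set where
    y⇒x : RArc y x
    x⇒z : ∀ j → RArc x (z j)
    z⇒y : ∀ j → RArc (z j) y

  ∈-R-arcs : ∀ j {e} → e List.∈ (x , z j) ∷ (z j , y) ∷ [] → e List.∈ Digraph.arcs (R n)
  ∈-R-arcs j e∈ =
    there (∈-concatMap⁺ (λ i → (x , z i) ∷ (z i , y) ∷ []) (Any.map (λ { refl → e∈ }) (∈-allFin j)))

  RArc⇒Arc : ∀ {u v} → RArc u v → Arc (R n) u v
  RArc⇒Arc y⇒x     = ∈arcs⇒Arc (R n) (here refl)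
  RArc⇒Arc (x⇒z j) = ∈arcs⇒Arc (R n) (∈-R-arcs j (here refl))
  RArc⇒Arc (z⇒y j) = ∈arcs⇒Arc (R n) (∈-R-arcs j (there (here refl)))

  Arc⇒RArc : ∀ {u v} → Arc (R n) u v → RArc u v
  Arc⇒RArc (arc i) = All.lookup arcsOfR (∈-lookup i)
    where
    arcsOfR : All (λ { (u , v) → RArc u v }) (Digraph.arcs (R n))
    arcsOfR = y⇒x ∷ concat⁺ (map⁺ (All.universal (λ j → x⇒z j ∷ z⇒y j ∷ []) (allFin n)))

module _ {m : ℕ} where
  private
    Rₘ = R (suc m)

  R-kernelless : ¬ HasKernel (Fin (suc (suc (suc m)))) (Arc Rₘ)
  R-kernelless (N , independent , absorbent) with N x in Nx
  ... | true with N (z f0) in Nz₀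
  ...   | true = independent x (z f0) Nx Nz₀ (RArc⇒Arc (x⇒z f0))
  ...   | false with absorbent (z f0) Nz₀
  ...     | v , Nv , z₀⇒v with Arc⇒RArc z₀⇒v
  ...       | z⇒y .f0 = independent y x Nv Nx (RArc⇒Arc y⇒x)
  R-kernelless (N , independent , absorbent) | false with absorbent x Nx
  ... | v , Nv , x⇒v with Arc⇒RArc x⇒v
  ... | x⇒z j with N y in Ny
  ...   | true = independent (z j) y Nv Ny (RArc⇒Arc (z⇒y j))
  ...   | false with absorbent y Ny
  ...     | w , Nw , y⇒w with Arc⇒RArc y⇒w
  ...       | y⇒x with trans (sym Nw) Nx
  ...         | ()

  -- The arc with index f0 is (y, x), the head of the arc list of R_n.
  subdivided-kernel : SubHasKernel Rₘ ⁅ f0 ⁆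
  subdivided-kernel = N , independent , absorbent
    where
    N : SubV Rₘ ⁅ f0 ⁆ → Bool
    N (inj₁ f0)          = false
    N (inj₁ (fs f0))     = false
    N (inj₁ (fs (fs _))) = true
    N (inj₂ _)           = true

    kept-independent : ∀ {u v} → RArc u v → N (inj₁ u) ≡ true → N (inj₁ v) ≡ true → ⊥
    kept-independent y⇒x     ()
    kept-independent (x⇒z _) ()
    kept-independent (z⇒y _) _ ()

    independent : Independent (SubArc Rₘ ⁅ f0 ⁆) N
    independent _ _ Nu Nv (keep i _) = kept-independent (Arc⇒RArc (arc i)) Nu Nv
    independent _ _ Nu Nv (into i i∈Λ) with x∈⁅y⁆⇒x≡y f0 i∈Λ
    independent _ _ () Nv (into .f0 _) | refl
    independent _ _ Nu Nv (outof i i∈Λ) with x∈⁅y⁆⇒x≡y f0 i∈Λ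
    independent _ _ Nu () (outof .f0 _) | refl

    absorbent : Absorbent (SubArc Rₘ ⁅ f0 ⁆) N
    absorbent (inj₁ f0)      _ = inj₁ (z f0) , refl , keep (fs f0) (x≢y⇒x∉⁅y⁆ {y = f0} λ ())
    absorbent (inj₁ (fs f0)) _ = inj₂ (f0 , x∈⁅x⁆ f0) , refl , into f0 _

mainTheorem4 : (n : ℕ) → 1 ≤ n → IsKappa (R n) 1
mainTheorem4 (suc m) _ = kernelless-κ≡1 (R (suc m)) R-kernelless f0 subdivided-kernel
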